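{- Let $(E,\#,\leq,l,\lessdot)$ be a prioritized Prime Event Structure and let $\lessdot'=\lessdot\setminus\{(e,e')\mid e'\# e\vee e'\leq e\vee e\leq e'\}$. Then $\mathrm{Traces}(E,\#,\leq,l,\lessdot)=\mathrm{Traces}(E,\#,\leq,l,\lessdot')$.
   Context: A Prime Event Structure (PES) is a quadruple $\delta=(E,\#,\leq,l)$ where $E$ is a set of events, $\#\subseteq E\times E$ is an irreflexive symmetric relation (conflict), $\leq\subseteq E\times E$ is a partial order (enabling), and $l:E\to Act$ is a labeling function, such that (Conflict Heredity) for all $e,e',e''\in E$, $e\# e'$ and $e'\leq e''$ imply $e\# e''$, and (Finite Causes) for every $e\in E$ the set $\{e'\in E\mid e'\leq e\}$ is finite. For a finite sequence $\sigma=e_1\cdots e_n$ of events write $\bar\sigma=\{e_1,\dots,e_n\}$ and $\sigma_i=e_1\cdots e_i$ ($\sigma_0$ the empty sequence). Define $\mathrm{en}_\delta(\sigma)=\{e\in E\setminus\bar\sigma\mid (\forall e'\in E.\ e'\leq e\wedge e'\neq e\Rightarrow e'\in\bar\sigma)\wedge \neg\exists e'\in\bar\sigma.\ e\# e'\}$. The sequence $\sigma$ is a trace of $\delta$ iff $e_i\in\mathrm{en}_\delta(\sigma_{i-1})$ for all $1\le i\le n$. A prioritized PES (PPES) $(E,\#,\leq,l,\lessdot)$ is a PES together with an acyclic relation $\lessdot\subseteq E\times E$ (priority; $e\lessdot e'$ means $e'$ has higher priority). A sequence $\sigma=e_1\cdots e_n$ is a trace of the PPES iff it is a trace of $(E,\#,\leq,l)$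 and for all $0\le i<n$ and all $e_j,e_h\in\bar\sigma$ with $e_j\neq e_h$, $e_j,e_h\in\mathrm{en}_\delta(\sigma_i)$ and $e_h\lessdot e_j$, we have $j<h$. $\mathrm{Traces}(\cdot)$ denotes the set of traces; the same definition is used when $\lessdot$ is replaced by any subrelation. -}

module Defs where

open import Data.Nat using (ℕ; _<_)
open import Data.Fin using (Fin; toℕ)
open import Data.List using (List; length; lookup; take)
open import Data.List.Membership.Propositional using (_∈_; _∉_)
open import Data.Product using (Σ; _×_; ∃; ∃-syntax)
open import Data.Sum using (_⊎_)
open import Relation.Nullary using (¬_)
open import Relation.Binary.PropositionalEquality using (_≡_; _≢_)
open import Relation.Binary.Construct.Closure.Transitive using (TransClosure)

record PES (E : Set) (Act : Set) : Set₁ where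
  field
    _#_ : E → E → Set
    _≤E_ : E → E → Set
    l : E → Act
    #-irrefl : ∀ e → ¬ (e # e)
    #-sym : ∀ e e′ → e # e′ → e′ # e
    ≤-refl : ∀ e → e ≤E e
    ≤-trans : ∀ e e′ e″ → e ≤E e′ → e′ ≤E e″ → e ≤E e″
    ≤-antisym : ∀ e e′ → e ≤E e′ → e′ ≤E e → e ≡ e′
    heredity : ∀ e e′ e″ → e # e′ → e′ ≤E e″ → e # e″
    finite-causes : ∀ e → ∃[ xs ] (∀ e′ → e′ ≤E e → e′ ∈ xs)

Acyclic : {E : Set} → (E → E → Set) → Set
Acyclic {E} R = ∀ (e : E) → ¬ TransClosure R e e

record PPES (E : Set) (Act : Set) : Set₁ where
  field
    pes : PES E Act
    _⋖_ : E → E → Set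
    ⋖-acyclic : Acyclic _⋖_
  open PES pes public

module _ {E Act : Set} (δ : PES E Act) where
  open PES δ

  en : List E → E → Set
  en σ e = (e ∉ σ)
         × (∀ e′ → e′ ≤E e → e′ ≢ e → e′ ∈ σ)
         × ¬ (∃[ e′ ] (e′ ∈ σ × e # e′))

  -- σ = e₁⋯eₙ is a trace: eᵢ ∈ en(σ_{i-1}) (0-based: σ[i] ∈ en(take i σ))
  IsTrace : List E → Set
  IsTrace σ = ∀ (i : Fin (length σ)) → en (take (toℕ i) σ) (lookup σ i)

  PriorityOK : (E → E → Set) → List E → Set
  PriorityOK P σ =
    ∀ (i : ℕ) → i < length σ →
    ∀ (j h : Fin (length σ)) →
    lookup σ j ≢ lookup σ h →
    en (take i σ) (lookup σ j) →
    en (take i σ) (lookup σ h) →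
    P (lookup σ h) (lookup σ j) →
    toℕ j < toℕ h

  IsPTrace : (E → E → Set) → List E → Set
  IsPTrace P σ = IsTrace σ × PriorityOK P σ

reducedPriority : {E Act : Set} → PPES E Act → E → E → Set
reducedPriority δ e e′ = (e ⋖ e′) × ¬ ((e′ # e) ⊎ (e′ ≤E e) ⊎ (e ≤E e′))
  where open PPES δ

-- Removing from the priority the pairs related by conflict or causality removes
-- only pairs that never constrain a trace. Two distinct events enabled after the
-- same prefix are causally unrelated, since each would otherwise be a proper
-- cause of the other and hence already occurred; and two events of one trace are
-- never in conflict, since the later one would not have been enabled.
module Submission where

open import Defs
open import Data.List using (List; _∷_; length; lookup; take)
open import Data.List.Membership.Propositional using (_∈_)
open import Data.List.Relation.Unary.Any using (here; there)
open import Data.Fin using (Fin; toℕ; zero; suc)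
open import Data.Fin.Properties using (<-cmp)
open import Data.Nat using (ℕ; suc; _<_; s≤s)
open import Data.Product using (_,_; proj₁; proj₂)
open import Data.Sum using (_⊎_; inj₁; inj₂)
open import Function.Base using (_∘_)
open import Function.Bundles using (_⇔_; mk⇔)
open import Relation.Binary.Definitions using (tri<; tri≈; tri>)
open import Relation.Binary.PropositionalEquality using (_≢_; refl; sym)
open import Relation.Nullary using (¬_)

lookup∈take : {A : Set} (xs : List A) (i : Fin (length xs)) {n : ℕ} →
              toℕ i < n → lookup xs i ∈ take n xs
lookup∈take (x ∷ xs) zero    {suc n} _       = here refl
lookup∈take (x ∷ xs) (suc i) {suc n} (s≤s p) = there (lookup∈take xs i p)

PriorityOK-antitone : {E Act : Set} (δ : PES E Act) {P Q : E → E → Set} →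
                      (∀ {e e′} → P e e′ → Q e e′) →
                      ∀ {σ} → PriorityOK δ Q σ → PriorityOK δ P σ
PriorityOK-antitone δ P⊆Q ok i i<n j h ne enj enh p = ok i i<n j h ne enj enh (P⊆Q p)

module _ {E Act : Set} (δ : PES E Act) where
  open PES δ

  en-causally-unrelated : ∀ {σ e e′} → en δ σ e → en δ σ e′ → e ≢ e′ → ¬ (e ≤E e′)
  en-causally-unrelated (e∉σ , _) (_ , causes-e′ , _) e≢e′ e≤e′ =
    e∉σ (causes-e′ _ e≤e′ e≢e′)

  trace-conflict-free : ∀ {σ} → IsTrace δ σ → ∀ j h → ¬ (lookup σ j # lookup σ h)
  trace-conflict-free {σ} tr j h c with <-cmp j h
  ... | tri< j<h _ _ = proj₂ (proj₂ (tr h)) (lookup σ j , lookup∈take σ j j<h , #-sym _ _ c)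
  ... | tri≈ _ refl _ = #-irrefl _ c
  ... | tri> _ _ h<j = proj₂ (proj₂ (tr j)) (lookup σ h , lookup∈take σ h h<j , c)

  co-enabled-unrelated : ∀ {σ} → IsTrace δ σ → ∀ {τ} j h → lookup σ j ≢ lookup σ h →
                         en δ τ (lookup σ j) → en δ τ (lookup σ h) →
                         ¬ ((lookup σ j # lookup σ h) ⊎ (lookup σ j ≤E lookup σ h) ⊎ (lookup σ h ≤E lookup σ j))
  co-enabled-unrelated tr j h _  _   _   (inj₁ c)          = trace-conflict-free tr j h c
  co-enabled-unrelated _  _ _ ne enj enh (inj₂ (inj₁ j≤h)) = en-causally-unrelated enj enh ne j≤h
  co-enabled-unrelated _  _ _ ne enj enh (inj₂ (inj₂ h≤j)) = en-causally-unrelated enh enj (ne ∘ sym) h≤j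

theorem1 : {E Act : Set} (δ : PPES E Act) (σ : List E) →
    IsPTrace (PPES.pes δ) (PPES._⋖_ δ) σ ⇔ IsPTrace (PPES.pes δ) (reducedPriority δ) σ
theorem1 δ σ = mk⇔ forget-side-conditions restore-side-conditions
  where
  open PPES δ

  forget-side-conditions : IsPTrace pes _⋖_ σ → IsPTrace pes (reducedPriority δ) σ
  forget-side-conditions (tr , ok) = tr , PriorityOK-antitone pes {P = reducedPriority δ} proj₁ ok

  restore-side-conditions : IsPTrace pes (reducedPriority δ) σ → IsPTrace pes _⋖_ σ
  restore-side-conditions (tr , ok) = tr , λ i i<n j h ne enj enh h⋖j →
    ok i i<n j h ne enj enh (h⋖j , co-enabled-unrelated pes tr j h ne enj enh)
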